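{- For any integer $n \geq 2$, the Laplacian eigenvalue $4n$ of the power graph $\mathcal{G}(Q_n)$ has multiplicity two if $Q_n$ is generalized quaternion (i.e., $n$ is a power of $2$) and multiplicity one otherwise.
   Context: For $n\ge 2$, the dicyclic group $Q_n$ is the group of order $4n$ with presentation $\langle a,b \mid a^{2n}=e,\ a^n=b^2,\ ab=ba^{ -1}\rangle$; it is generalized quaternion when $n$ is a power of $2$. The power graph $\mathcal{G}(G)$ of a group $G$ has vertex set $G$, distinct $u,v$ adjacent iff one is a positive power of the other. Laplacian eigenvalues are eigenvalues of $L(\Gamma)=D(\Gamma)-A(\Gamma)$. -}

module Defs where

open import Data.Nat as ℕ using (ℕ; zero; suc)
open import Data.Nat.DivMod using (_mod_)
open import Data.Fin as Fin using (Fin; toℕ)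
open import Data.Fin.Properties using () renaming (_≟_ to _≟F_)
open import Data.Bool using (Bool; true; false; if_then_else_)
open import Data.Bool.Properties using () renaming (_≟_ to _≟B_)
open import Data.Product using (_×_; _,_; Σ; ∃)
open import Data.Product.Properties using (≡-dec)
open import Data.Sum using (_⊎_)
open import Data.List using (List; []; _∷_; foldr; map; filter; length; cartesianProduct; allFin)
open import Data.Integer using (ℤ; +_; -[1+_])
open import Data.Rational using (ℚ; 0ℚ; _/_) renaming (_+_ to _+ℚ_; _*_ to _*ℚ_; _-_ to _-ℚ_)
open import Relation.Binary.PropositionalEquality using (_≡_; _≢_)
open import Relation.Nullary using (Dec; does; ¬_)
open import Relation.Binary.Definitions using (DecidableEquality)

-- Modular arithmetic on Fin m (Fin 0 is empty, so these are total).

addMod : ∀ {m} → Fin m → Fin m → Fin m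
addMod {suc m} i j = (toℕ i ℕ.+ toℕ j) mod suc m

negMod : ∀ {m} → Fin m → Fin m
negMod {suc m} i = (suc m ℕ.∸ toℕ i) mod suc m

addNat : ∀ {m} → Fin m → ℕ → Fin m
addNat {suc m} i k = (toℕ i ℕ.+ k) mod suc m

-- The dicyclic group Q_n = < a, b | a^{2n} = e, a^n = b^2, ab = ba^{-1} >,
-- in normal form: (i , j) represents a^i b^j with i ∈ Z/2n, j ∈ {0,1}
-- (false = 0, true = 1).  Multiplication:
--   a^i · a^k b^l     = a^{i+k} b^l
--   a^i b · a^k       = a^{i-k} b
--   a^i b · a^k b     = a^{i-k+n}

Q : ℕ → Set
Q n = Fin (2 ℕ.* n) × Bool

mulQ : ∀ n → Q n → Q n → Q n
mulQ n (i , false) (k , l)     = addMod i k , l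
mulQ n (i , true)  (k , false) = addMod i (negMod k) , true
mulQ n (i , true)  (k , true)  = addNat (addMod i (negMod k)) n , false

-- powQ n g m = g^(m+1), i.e. the positive powers of g.
powQ : ∀ n → Q n → ℕ → Q n
powQ n g zero    = g
powQ n g (suc m) = mulQ n (powQ n g m) g

_≟Q_ : ∀ {n} → DecidableEquality (Q n)
_≟Q_ = ≡-dec _≟F_ _≟B_

allQ : ∀ n → List (Q n)
allQ n = cartesianProduct (allFin (2 ℕ.* n)) (false ∷ true ∷ [])

PowerAdj : ∀ n → Q n → Q n → Set
PowerAdj n u v = u ≢ v × ∃ λ m → (v ≡ powQ n u m) ⊎ (u ≡ powQ n v m)

-- It is built from any decision procedure for adjacency (the result does
-- not depend on which one, since Dec of a proposition has a fixed answer).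

module Laplacian (n : ℕ) (adj? : ∀ u v → Dec (PowerAdj n u v)) where

  degree : Q n → ℕ
  degree u = length (filter (adj? u) (allQ n))

  L : Q n → Q n → ℚ
  L u v = if does (_≟Q_ {n} u v) then (+ degree u) / 1
          else (if does (adj? u v) then -[1+ 0 ] / 1 else 0ℚ)

sumQ : ∀ {A : Set} → List A → (A → ℚ) → ℚ
sumQ xs f = foldr (λ x acc → f x +ℚ acc) 0ℚ xs

sumFin : ∀ k → (Fin k → ℚ) → ℚ
sumFin k f = sumQ (allFin k) f

InEigenspace : ∀ n → (Q n → Q n → ℚ) → ℚ → (Q n → ℚ) → Set
InEigenspace n M λ' v = ∀ u → sumQ (allQ n) (λ w → M u w *ℚ v w) ≡ λ' *ℚ v u

LinIndep : ∀ n k → (Fin k → Q n → ℚ) → Set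
LinIndep n k w = ∀ (c : Fin k → ℚ) →
  (∀ u → sumFin k (λ i → c i *ℚ w i u) ≡ 0ℚ) → ∀ i → c i ≡ 0ℚ

EigenMultiplicity : ∀ n → (Q n → Q n → ℚ) → ℚ → ℕ → Set
EigenMultiplicity n M λ' k =
  (Σ (Fin k → Q n → ℚ) λ w → (∀ i → InEigenspace n M λ' (w i)) × LinIndep n k w)
  × (∀ (w : Fin (suc k) → Q n → ℚ) → (∀ i → InEigenspace n M λ' (w i)) → ¬ LinIndep n (suc k) w)

IsPowerOf2 : ℕ → Set
IsPowerOf2 n = ∃ λ k → n ≡ 2 ℕ.^ k

module Submission where

-- For the eigenvalue |Q_n| = 4n an eigenvector v of the Laplacian has zero sum, so at every vertex u the
-- eigen-equation says Σ (v u − v w) = 0 over the non-neighbours w of u. A maximum principle on the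
-- complement graph then makes v constant on any set of vertices that is closed under non-adjacency and
-- connected by non-edges. In Q_n the identity is adjacent to every vertex, and so is aⁿ exactly when n
-- is a power of 2; all other vertices are joined to b by paths of non-edges. Hence the eigenspace
-- consists of the zero-sum vectors that are constant off these dominating vertices x, and the vectors
-- 4n·δₓ − 1 form a basis of it: its dimension is 2 or 1.

open import Defs
open import Data.Nat using (ℕ; zero; suc; _+_; _*_; _∸_; _^_; _≤_; _<_; _%_; s≤s; z≤n)
import Data.Nat as ℕ
import Data.Nat.Properties as ℕP
import Data.Nat.DivMod as DM
open DM using (_mod_)
open import Data.Nat.Divisibility using (_∣_; divides; ∣-refl; n∣m⇒m%n≡0; %-presˡ-∣; ∣m⇒∣m*n; *-cancelˡ-∣; ∣⇒≤; n∣m*n)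
open import Data.Nat.Induction using (<-rec)
open import Data.Nat.Tactic.RingSolver using (solve-∀)
import Data.Nat.Coprimality as Coprime
open import Data.Integer using (+_)
import Data.Integer as ℤ
import Data.Integer.Properties as ℤP
open import Data.Rational using (ℚ; mkℚ; 0ℚ; 1ℚ; 1/_; toℚᵘ; _/_; ≢-nonZero)
  renaming (_+_ to _+ℚ_; _*_ to _*ℚ_; _-_ to _-ℚ_; -_ to -ℚ_; _≤_ to _≤ℚ_)
import Data.Rational.Properties
open Data.Rational.Properties
  using (normalize-coprime; toℚᵘ-injective; toℚᵘ-homo-+; *-identityˡ; *-inverseˡ; *-assoc;
         *-zeroʳ; *-zeroˡ; *-comm; +-identityˡ; +-identityʳ; +-inverseʳ; neg-injective;
         ≤-antisym; ≤-refl; +-mono-≤; +-monoʳ-≤; +-monoˡ-≤; ≤-decTotalOrder; 1≢0)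
  renaming (_≟_ to _≟ℚ_)
import Data.Rational.Unnormalised as ℚᵘ
import Data.Rational.Unnormalised.Properties as ℚᵘP
open import Data.Rational.Solver using (module +-*-Solver)
open +-*-Solver
open import Algebra.Properties.Group Data.Rational.Properties.+-0-group
  using () renaming (x∙y⁻¹≈ε⇒x≈y to p-q≡0⇒p≡q)
open import Data.Fin as Fin using (Fin; toℕ)
import Data.Fin.Properties as FinP
open import Data.Bool using (Bool; true; false; if_then_else_)
open import Data.Product using (_×_; _,_; ∃; ∃-syntax; proj₁; proj₂; map₂; swap)
open import Data.Sum using (_⊎_; inj₁; inj₂; [_,_]′)
open import Data.List using (List; []; _∷_; filter; length; allFin; cartesianProduct)
import Data.List.Properties as ListP
open import Data.List.Relation.Unary.All as All using (All)
import Data.List.Relation.Unary.All.Properties as AllP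
import Data.List.Relation.Unary.AllPairs as AllPairs
open import Data.List.Relation.Unary.Any using (here; there)
open import Data.List.Relation.Unary.Unique.Propositional using (Unique)
import Data.List.Relation.Unary.Unique.Propositional.Properties as UniqueP
open import Data.List.Membership.Propositional using (_∈_)
import Data.List.Membership.Propositional.Properties as MemP
open import Relation.Binary.Bundles using (DecTotalOrder; Setoid)
open import Data.List.Extrema (DecTotalOrder.totalOrder ≤-decTotalOrder)
  using (argmax; argmax-all; f[xs]≤f[argmax])
open import Function using (_∘_; case_of_)
open import Level using (0ℓ)
open import Relation.Nullary using (Dec; yes; no; does; ¬_; ¬?; contradiction)
open import Relation.Nullary.Decidable using (dec-true; dec-false; toSum)
open import Relation.Binary.PropositionalEquality hiding ([_])
open import Relation.Binary.Structures using (IsEquivalence)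
import Relation.Binary.Reasoning.Setoid as SetoidReasoning
open import Relation.Binary.Construct.Closure.ReflexiveTransitive using (Star; ε; _◅_; reverse)

fromℕ : ℕ → ℚ
fromℕ m = ℤ.+ m / 1

fromℕ≡mkℚ : ∀ m → fromℕ m ≡ mkℚ (ℤ.+ m) 0 (Coprime.sym (Coprime.1-coprimeTo m))
fromℕ≡mkℚ m = normalize-coprime (Coprime.sym (Coprime.1-coprimeTo m))

fromℕ-suc : ∀ m → fromℕ (suc m) ≡ 1ℚ +ℚ fromℕ m
fromℕ-suc m = toℚᵘ-injective (ℚᵘP.≃-trans unnormalised (ℚᵘP.≃-sym (toℚᵘ-homo-+ 1ℚ (fromℕ m))))
  where
  unnormalised : toℚᵘ (fromℕ (suc m)) ℚᵘ.≃ (toℚᵘ 1ℚ ℚᵘ.+ toℚᵘ (fromℕ m))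
  unnormalised rewrite fromℕ≡mkℚ m | fromℕ≡mkℚ (suc m) | ℕP.*-identityʳ m =
    ℚᵘ.*≡* (trans (ℤP.*-identityʳ _)
      (trans (cong (ℤ._+_ (ℤ.+ 1)) (sym (ℤP.+◃n≡+n m))) (sym (ℤP.*-identityʳ _))))

fromℕ≢0 : ∀ m .{{_ : ℕ.NonZero m}} → fromℕ m ≢ 0ℚ
fromℕ≢0 (suc m) eq with trans (sym (fromℕ≡mkℚ (suc m))) (trans eq (fromℕ≡mkℚ 0))
... | ()

*-cancelˡ-≡0 : ∀ p q → p ≢ 0ℚ → p *ℚ q ≡ 0ℚ → q ≡ 0ℚ
*-cancelˡ-≡0 p q p≢0 pq≡0 = begin
  q                  ≡⟨ sym (*-identityˡ q) ⟩
  1ℚ *ℚ q            ≡⟨ cong (_*ℚ q) (sym (*-inverseˡ p {{≢-nonZero p≢0}})) ⟩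
  (1/ p *ℚ p) *ℚ q   ≡⟨ *-assoc (1/ p) p q ⟩
  1/ p *ℚ (p *ℚ q)   ≡⟨ cong (1/ p *ℚ_) pq≡0 ⟩
  1/ p *ℚ 0ℚ         ≡⟨ *-zeroʳ (1/ p) ⟩
  0ℚ                 ∎
  where
  open ≡-Reasoning
  instance _ = ≢-nonZero p≢0

if-0-+-if-0 : ∀ b (x : ℚ) → (if b then 0ℚ else x) +ℚ (if b then x else 0ℚ) ≡ x
if-0-+-if-0 true  x = +-identityˡ x
if-0-+-if-0 false x = +-identityʳ x

if-0-scale : ∀ b (c : ℚ) {x y} → x ≡ c *ℚ y → (if b then x else 0ℚ) ≡ c *ℚ (if b then y else 0ℚ)
if-0-scale true  c x≡cy = x≡cy
if-0-scale false c _    = sym (*-zeroʳ c)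

if-0-nonneg : ∀ {P : Set} (P? : Dec P) {x} → (¬ P → 0ℚ ≤ℚ x) → 0ℚ ≤ℚ (if does P? then 0ℚ else x)
if-0-nonneg (yes _) _    = ≤-refl
if-0-nonneg (no ¬p) 0≤x = 0≤x ¬p

nonneg-+-≡0 : ∀ {p q} → 0ℚ ≤ℚ p → 0ℚ ≤ℚ q → p +ℚ q ≡ 0ℚ → p ≡ 0ℚ × q ≡ 0ℚ
nonneg-+-≡0 {p} {q} 0≤p 0≤q p+q≡0 =
  ≤-antisym (subst₂ _≤ℚ_ (+-identityʳ p) p+q≡0 (+-monoʳ-≤ p 0≤q)) 0≤p ,
  ≤-antisym (subst₂ _≤ℚ_ (+-identityˡ q) p+q≡0 (+-monoˡ-≤ q 0≤p)) 0≤q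

module _ {A : Set} where

  sumQ-cong : ∀ (xs : List A) {f g : A → ℚ} → (∀ x → f x ≡ g x) → sumQ xs f ≡ sumQ xs g
  sumQ-cong []       f≗g = refl
  sumQ-cong (x ∷ xs) f≗g = cong₂ _+ℚ_ (f≗g x) (sumQ-cong xs f≗g)

  sumQ-zero : ∀ (xs : List A) {f : A → ℚ} → (∀ x → f x ≡ 0ℚ) → sumQ xs f ≡ 0ℚ
  sumQ-zero []       f≗0 = refl
  sumQ-zero (x ∷ xs) f≗0 rewrite f≗0 x | sumQ-zero xs f≗0 = refl

  sumQ-+ : ∀ (xs : List A) (f g : A → ℚ) →
           sumQ xs (λ x → f x +ℚ g x) ≡ sumQ xs f +ℚ sumQ xs g
  sumQ-+ []       f g = refl
  sumQ-+ (x ∷ xs) f g rewrite sumQ-+ xs f g =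
    solve 4 (λ a b c d → (a :+ b) :+ (c :+ d) := (a :+ c) :+ (b :+ d)) refl
      (f x) (g x) (sumQ xs f) (sumQ xs g)

  sumQ-neg : ∀ (xs : List A) (f : A → ℚ) → sumQ xs (λ x → -ℚ f x) ≡ -ℚ sumQ xs f
  sumQ-neg []       f = refl
  sumQ-neg (x ∷ xs) f rewrite sumQ-neg xs f =
    solve 2 (λ a b → (:- a) :+ (:- b) := :- (a :+ b)) refl (f x) (sumQ xs f)

  sumQ-- : ∀ (xs : List A) (f g : A → ℚ) →
           sumQ xs (λ x → f x -ℚ g x) ≡ sumQ xs f -ℚ sumQ xs g
  sumQ-- xs f g = trans (sumQ-+ xs f (λ x → -ℚ g x)) (cong (sumQ xs f +ℚ_) (sumQ-neg xs g))

  sumQ-*ˡ : ∀ (xs : List A) (c : ℚ) (f : A → ℚ) → sumQ xs (λ x → c *ℚ f x) ≡ c *ℚ sumQ xs f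
  sumQ-*ˡ []       c f = sym (*-zeroʳ c)
  sumQ-*ˡ (x ∷ xs) c f rewrite sumQ-*ˡ xs c f =
    solve 3 (λ c a b → c :* a :+ c :* b := c :* (a :+ b)) refl c (f x) (sumQ xs f)

  sumQ-*ʳ : ∀ (xs : List A) (c : ℚ) (f : A → ℚ) → sumQ xs (λ x → f x *ℚ c) ≡ sumQ xs f *ℚ c
  sumQ-*ʳ xs c f =
    trans (sumQ-cong xs (λ x → *-comm (f x) c)) (trans (sumQ-*ˡ xs c f) (*-comm c _))

  sumQ-const : ∀ (xs : List A) (c : ℚ) → sumQ xs (λ _ → c) ≡ fromℕ (length xs) *ℚ c
  sumQ-const []       c = sym (*-zeroˡ c)
  sumQ-const (x ∷ xs) c = begin
    c +ℚ sumQ xs (λ _ → c)            ≡⟨ cong (c +ℚ_) (sumQ-const xs c) ⟩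
    c +ℚ fromℕ (length xs) *ℚ c       ≡⟨ solve 2 (λ c l → c :+ l :* c := (con 1ℚ :+ l) :* c) refl c (fromℕ (length xs)) ⟩
    (1ℚ +ℚ fromℕ (length xs)) *ℚ c    ≡⟨ cong (_*ℚ c) (sym (fromℕ-suc (length xs))) ⟩
    fromℕ (suc (length xs)) *ℚ c      ∎
    where open ≡-Reasoning

  sumQ-length-filter : ∀ {P : A → Set} (P? : ∀ x → Dec (P x)) (xs : List A) →
                       fromℕ (length (filter P? xs)) ≡ sumQ xs (λ x → if does (P? x) then 1ℚ else 0ℚ)
  sumQ-length-filter P? [] = refl
  sumQ-length-filter P? (x ∷ xs) with does (P? x)
  ... | true  = trans (fromℕ-suc (length (filter P? xs))) (cong (1ℚ +ℚ_) (sumQ-length-filter P? xs))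
  ... | false = trans (sumQ-length-filter P? xs) (sym (+-identityˡ _))

  sumQ-delta : ∀ (xs : List A) {u : A} (f : A → ℚ) → Unique xs → u ∈ xs →
               (∀ x → x ≢ u → f x ≡ 0ℚ) → sumQ xs f ≡ f u
  sumQ-delta (x ∷ xs) f (x∉xs AllPairs.∷ _) (here refl) f≗0 =
    trans (cong (f x +ℚ_) (rest xs x∉xs)) (+-identityʳ (f x))
    where
    rest : ∀ ys → All (x ≢_) ys → sumQ ys f ≡ 0ℚ
    rest []       All.[]             = refl
    rest (y ∷ ys) (x≢y All.∷ x≢ys) rewrite f≗0 y (≢-sym x≢y) | rest ys x≢ys = refl
  sumQ-delta (x ∷ xs) f (x∉xs AllPairs.∷ uniq) (there u∈xs) f≗0 =
    trans (cong₂ _+ℚ_ (f≗0 x (λ x≡u → All.lookup x∉xs u∈xs x≡u)) (sumQ-delta xs f uniq u∈xs f≗0))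
          (+-identityˡ _)

  sumQ-nonneg : ∀ (xs : List A) (f : A → ℚ) → (∀ x → 0ℚ ≤ℚ f x) → 0ℚ ≤ℚ sumQ xs f
  sumQ-nonneg []       f f≥0 = ≤-refl
  sumQ-nonneg (x ∷ xs) f f≥0 =
    subst (_≤ℚ sumQ (x ∷ xs) f) (+-identityˡ 0ℚ) (+-mono-≤ (f≥0 x) (sumQ-nonneg xs f f≥0))

  sumQ-nonneg-≡0 : ∀ (xs : List A) (f : A → ℚ) → (∀ x → 0ℚ ≤ℚ f x) →
                   sumQ xs f ≡ 0ℚ → ∀ {x} → x ∈ xs → f x ≡ 0ℚ
  sumQ-nonneg-≡0 (y ∷ ys) f f≥0 sum≡0 (here refl) =
    proj₁ (nonneg-+-≡0 (f≥0 y) (sumQ-nonneg ys f f≥0) sum≡0)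
  sumQ-nonneg-≡0 (y ∷ ys) f f≥0 sum≡0 (there x∈ys) =
    sumQ-nonneg-≡0 ys f f≥0 (proj₂ (nonneg-+-≡0 (f≥0 y) (sumQ-nonneg ys f f≥0) sum≡0)) x∈ys

sumQ-swap : ∀ {A B : Set} (xs : List A) (ys : List B) (f : A → B → ℚ) →
            sumQ xs (λ x → sumQ ys (f x)) ≡ sumQ ys (λ y → sumQ xs (λ x → f x y))
sumQ-swap []       ys f = sym (sumQ-zero ys (λ _ → refl))
sumQ-swap (x ∷ xs) ys f rewrite sumQ-swap xs ys f =
  sym (sumQ-+ ys (f x) (λ y → sumQ xs (λ x → f x y)))

dot : ∀ {k} → (Fin k → ℚ) → (Fin k → ℚ) → ℚ
dot {k} c x = sumFin k (λ i → c i *ℚ x i)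

Nontrivial : ∀ {k} → (Fin k → ℚ) → Set
Nontrivial c = ∃ λ i → c i ≢ 0ℚ

*-≢0 : ∀ p q → p ≢ 0ℚ → q ≢ 0ℚ → p *ℚ q ≢ 0ℚ
*-≢0 p q p≢0 q≢0 pq≡0 = q≢0 (*-cancelˡ-≡0 p q p≢0 pq≡0)

one-equation-two-unknowns : ∀ (y : Fin 2 → ℚ) → ∃ λ c → Nontrivial c × dot c y ≡ 0ℚ
one-equation-two-unknowns y with y Fin.zero ≟ℚ 0ℚ
... | yes y₀≡0 = c , (Fin.zero , 1≢0) ,
      trans (solve 2 (λ y₀ y₁ → con 1ℚ :* y₀ :+ (con 0ℚ :* y₁ :+ con 0ℚ) := y₀) refl (y Fin.zero) (y (Fin.suc Fin.zero))) y₀≡0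
  where
  c : Fin 2 → ℚ
  c Fin.zero    = 1ℚ
  c (Fin.suc _) = 0ℚ
... | no y₀≢0 = c , (Fin.suc Fin.zero , λ -y₀≡0 → y₀≢0 (neg-injective -y₀≡0)) ,
      solve 2 (λ y₀ y₁ → y₁ :* y₀ :+ ((:- y₀) :* y₁ :+ con 0ℚ) := con 0ℚ) refl (y Fin.zero) (y (Fin.suc Fin.zero))
  where
  c : Fin 2 → ℚ
  c Fin.zero    = y (Fin.suc Fin.zero)
  c (Fin.suc _) = -ℚ y Fin.zero

-- Solve the first equation for c₀ (up to the factor x₀); the second becomes one equation in c₁, c₂.
private
  eliminate-first-unknown : ∀ (x y : Fin 3 → ℚ) → x Fin.zero ≢ 0ℚ →
                            ∃ λ c → Nontrivial c × dot c x ≡ 0ℚ × dot c y ≡ 0ℚ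
  eliminate-first-unknown x y x₀≢0 with one-equation-two-unknowns y′
    where
    y′ : Fin 2 → ℚ
    y′ Fin.zero    = x Fin.zero *ℚ y (Fin.suc Fin.zero) -ℚ x (Fin.suc Fin.zero) *ℚ y Fin.zero
    y′ (Fin.suc _) = x Fin.zero *ℚ y (Fin.suc (Fin.suc Fin.zero)) -ℚ x (Fin.suc (Fin.suc Fin.zero)) *ℚ y Fin.zero
  ... | c′ , (i , c′ᵢ≢0) , c′·y′≡0 =
    c , (Fin.suc i , *-≢0 x₀ (c′ i) x₀≢0 c′ᵢ≢0) ,
    solve 5 (λ x₀ x₁ x₂ a b →
      (:- (x₁ :* a :+ x₂ :* b)) :* x₀ :+ (x₀ :* a :* x₁ :+ (x₀ :* b :* x₂ :+ con 0ℚ)) := con 0ℚ)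
      refl x₀ x₁ x₂ a b ,
    trans (solve 8 (λ x₀ x₁ x₂ y₀ y₁ y₂ a b →
      (:- (x₁ :* a :+ x₂ :* b)) :* y₀ :+ (x₀ :* a :* y₁ :+ (x₀ :* b :* y₂ :+ con 0ℚ))
        := a :* (x₀ :* y₁ :- x₁ :* y₀) :+ (b :* (x₀ :* y₂ :- x₂ :* y₀) :+ con 0ℚ))
      refl x₀ x₁ x₂ (y Fin.zero) (y (Fin.suc Fin.zero)) (y (Fin.suc (Fin.suc Fin.zero))) a b)
      c′·y′≡0
    where
    x₀ = x Fin.zero
    x₁ = x (Fin.suc Fin.zero)
    x₂ = x (Fin.suc (Fin.suc Fin.zero))
    a = c′ Fin.zero
    b = c′ (Fin.suc Fin.zero)
    c : Fin 3 → ℚ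
    c Fin.zero    = -ℚ (x₁ *ℚ a +ℚ x₂ *ℚ b)
    c (Fin.suc j) = x₀ *ℚ c′ j

two-equations-three-unknowns : ∀ (x y : Fin 3 → ℚ) →
                               ∃ λ c → Nontrivial c × dot c x ≡ 0ℚ × dot c y ≡ 0ℚ
two-equations-three-unknowns x y with x Fin.zero ≟ℚ 0ℚ | y Fin.zero ≟ℚ 0ℚ
... | no x₀≢0  | _        = eliminate-first-unknown x y x₀≢0
... | yes _    | no y₀≢0  = map₂ (map₂ swap) (eliminate-first-unknown y x y₀≢0)
... | yes x₀≡0 | yes y₀≡0 = c , (Fin.zero , 1≢0) , first x x₀≡0 , first y y₀≡0
  where
  c : Fin 3 → ℚ
  c Fin.zero    = 1ℚ
  c (Fin.suc _) = 0ℚ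
  first : ∀ z → z Fin.zero ≡ 0ℚ → dot c z ≡ 0ℚ
  first z z₀≡0 = trans (solve 3 (λ z₀ z₁ z₂ → con 1ℚ :* z₀ :+ (con 0ℚ :* z₁ :+ (con 0ℚ :* z₂ :+ con 0ℚ)) := z₀)
                          refl (z Fin.zero) (z (Fin.suc Fin.zero)) (z (Fin.suc (Fin.suc Fin.zero)))) z₀≡0

lincomb : ∀ n {k} → (Fin k → Q n → ℚ) → (Fin k → ℚ) → Q n → ℚ
lincomb n {k} w c u = sumFin k (λ i → c i *ℚ w i u)

lincomb-InEigenspace : ∀ {n k} (M : Q n → Q n → ℚ) (μ : ℚ) (w : Fin k → Q n → ℚ) (c : Fin k → ℚ) →
                       (∀ i → InEigenspace n M μ (w i)) → InEigenspace n M μ (lincomb n w c)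
lincomb-InEigenspace {n} {k} M μ w c eigen u = begin
  sumQ (allQ n) (λ x → M u x *ℚ sumFin k (λ i → c i *ℚ w i x))
    ≡⟨ sumQ-cong (allQ n) (λ x → sym (sumQ-*ˡ (allFin k) (M u x) (λ i → c i *ℚ w i x))) ⟩
  sumQ (allQ n) (λ x → sumFin k (λ i → M u x *ℚ (c i *ℚ w i x)))
    ≡⟨ sumQ-swap (allQ n) (allFin k) (λ x i → M u x *ℚ (c i *ℚ w i x)) ⟩
  sumFin k (λ i → sumQ (allQ n) (λ x → M u x *ℚ (c i *ℚ w i x)))
    ≡⟨ sumQ-cong (allFin k) (λ i → sumQ-cong (allQ n) (λ x → rearrange (M u x) (c i) (w i x))) ⟩
  sumFin k (λ i → sumQ (allQ n) (λ x → c i *ℚ (M u x *ℚ w i x)))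
    ≡⟨ sumQ-cong (allFin k) (λ i → sumQ-*ˡ (allQ n) (c i) (λ x → M u x *ℚ w i x)) ⟩
  sumFin k (λ i → c i *ℚ sumQ (allQ n) (λ x → M u x *ℚ w i x))
    ≡⟨ sumQ-cong (allFin k) (λ i → trans (cong (c i *ℚ_) (eigen i u)) (rearrange (c i) μ (w i u))) ⟩
  sumFin k (λ i → μ *ℚ (c i *ℚ w i u))
    ≡⟨ sumQ-*ˡ (allFin k) μ (λ i → c i *ℚ w i u) ⟩
  μ *ℚ sumFin k (λ i → c i *ℚ w i u) ∎
  where
  open ≡-Reasoning
  rearrange : ∀ a b z → a *ℚ (b *ℚ z) ≡ b *ℚ (a *ℚ z)
  rearrange = solve 3 (λ a b z → a :* (b :* z) := b :* (a :* z)) refl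

allQ-unique : ∀ n → Unique (allQ n)
allQ-unique n = UniqueP.cartesianProduct⁺ (UniqueP.allFin⁺ (2 * n)) bools-unique
  where
  bools-unique : Unique (false ∷ true ∷ [])
  bools-unique = ((λ ()) All.∷ All.[]) AllPairs.∷ (All.[] AllPairs.∷ AllPairs.[])

∈-allQ : ∀ n (u : Q n) → u ∈ allQ n
∈-allQ n (i , b) = MemP.∈-cartesianProduct⁺ (MemP.∈-allFin i) (∈-bools b)
  where
  ∈-bools : ∀ b → b ∈ (false ∷ true ∷ [])
  ∈-bools false = here refl
  ∈-bools true  = there (here refl)

length-allQ : ∀ n → length (allQ n) ≡ 4 * n
length-allQ n = begin
  length (cartesianProduct (allFin (2 * n)) (false ∷ true ∷ []))
    ≡⟨ length-×bools (allFin (2 * n)) ⟩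
  2 * length (allFin (2 * n))   ≡⟨ cong (2 *_) (ListP.length-tabulate {n = 2 * n} (λ i → i)) ⟩
  2 * (2 * n)                   ≡⟨ ℕP.*-assoc 2 2 n ⟨
  4 * n                         ∎
  where
  open ≡-Reasoning
  length-×bools : ∀ {A : Set} (xs : List A) → length (cartesianProduct xs (false ∷ true ∷ [])) ≡ 2 * length xs
  length-×bools []       = refl
  length-×bools (x ∷ xs) rewrite length-×bools xs = cong suc (sym (ℕP.+-suc (length xs) (length xs + 0)))

sumAll-delta : ∀ n (u : Q n) (f : Q n → ℚ) → (∀ x → x ≢ u → f x ≡ 0ℚ) → sumQ (allQ n) f ≡ f u
sumAll-delta n u f = sumQ-delta (allQ n) f (allQ-unique n) (∈-allQ n u)

sumAll-const : ∀ n (c : ℚ) → sumQ (allQ n) (λ _ → c) ≡ fromℕ (4 * n) *ℚ c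
sumAll-const n c = trans (sumQ-const (allQ n) c) (cong (λ m → fromℕ m *ℚ c) (length-allQ n))

at-or-off : ∀ {n} (x : Q n) {P : Q n → Set} → P x → (∀ u → u ≢ x → P u) → ∀ u → P u
at-or-off {n} x Px P-off u with _≟Q_ {n} u x
... | yes refl = Px
... | no u≢x   = P-off u u≢x

-- The Laplacian of the power graph

PowerAdj-sym : ∀ {n} {u w : Q n} → PowerAdj n u w → PowerAdj n w u
PowerAdj-sym (u≢w , m , inj₁ w≡uᵐ) = ≢-sym u≢w , m , inj₂ w≡uᵐ
PowerAdj-sym (u≢w , m , inj₂ u≡wᵐ) = ≢-sym u≢w , m , inj₁ u≡wᵐ

NonAdj : ∀ n → Q n → Q n → Set
NonAdj n u w = ¬ PowerAdj n u w

NonAdj-sym : ∀ {n} {u w : Q n} → NonAdj n u w → NonAdj n w u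
NonAdj-sym ¬u~w w~u = ¬u~w (PowerAdj-sym w~u)

Dominating : ∀ n → Q n → Set
Dominating n x = ∀ w → w ≢ x → PowerAdj n w x

module LaplacianProperties (n : ℕ) (adj? : ∀ u v → Dec (PowerAdj n u v)) where
  open Laplacian n adj? public

  applyL : (Q n → ℚ) → Q n → ℚ
  applyL v u = sumQ (allQ n) (λ w → L u w *ℚ v w)

  adjDiff : (Q n → ℚ) → Q n → Q n → ℚ
  adjDiff v u w = if does (adj? u w) then v u -ℚ v w else 0ℚ

  private
    diagPart adjPart : (Q n → ℚ) → Q n → Q n → ℚ
    diagPart v u w = if does (_≟Q_ {n} u w) then fromℕ (degree u) *ℚ v u else 0ℚ
    adjPart  v u w = if does (adj? u w) then v u else 0ℚ

    entry-split′ : ∀ {P A : Set} (same? : Dec P) (adj? : Dec A) (d x y : ℚ) → (P → ¬ A) → (P → y ≡ x) →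
                   (if does same? then d else (if does adj? then -ℚ 1ℚ else 0ℚ)) *ℚ y
                     ≡ (if does same? then d *ℚ x else 0ℚ) +ℚ
                       ((if does adj? then x -ℚ y else 0ℚ) -ℚ (if does adj? then x else 0ℚ))
    entry-split′ (yes p) (yes a) d x y not-adj _ = contradiction a (not-adj p)
    entry-split′ (yes p) (no _)  d x y _ y≡x rewrite y≡x p =
      solve 2 (λ d x → d :* x := d :* x :+ (con 0ℚ :- con 0ℚ)) refl d x
    entry-split′ (no _) (yes _) d x y _ _ = solve 2 (λ x y → (:- con 1ℚ) :* y := con 0ℚ :+ ((x :- y) :- x)) refl x y
    entry-split′ (no _) (no _)  d x y _ _ = solve 1 (λ y → con 0ℚ :* y := con 0ℚ :+ (con 0ℚ :- con 0ℚ)) refl y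

    entry-split : ∀ v u w → L u w *ℚ v w ≡ diagPart v u w +ℚ (adjDiff v u w -ℚ adjPart v u w)
    entry-split v u w = entry-split′ (_≟Q_ {n} u w) (adj? u w) (fromℕ (degree u)) (v u) (v w)
      (λ { refl (u≢u , _) → u≢u refl })
      (λ u≡w → cong v (sym u≡w))

  applyL≡sum-adjDiff : ∀ v u → applyL v u ≡ sumQ (allQ n) (adjDiff v u)
  applyL≡sum-adjDiff v u = begin
    applyL v u
      ≡⟨ sumQ-cong (allQ n) (entry-split v u) ⟩
    sumQ (allQ n) (λ w → diagPart v u w +ℚ (adjDiff v u w -ℚ adjPart v u w))
      ≡⟨ sumQ-+ (allQ n) (diagPart v u) (λ w → adjDiff v u w -ℚ adjPart v u w) ⟩
    sumQ (allQ n) (diagPart v u) +ℚ sumQ (allQ n) (λ w → adjDiff v u w -ℚ adjPart v u w)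
      ≡⟨ cong₂ _+ℚ_ sum-diagPart (sumQ-- (allQ n) (adjDiff v u) (adjPart v u)) ⟩
    d *ℚ v u +ℚ (sumQ (allQ n) (adjDiff v u) -ℚ sumQ (allQ n) (adjPart v u))
      ≡⟨ cong (λ s → d *ℚ v u +ℚ (sumQ (allQ n) (adjDiff v u) -ℚ s)) sum-adjPart ⟩
    d *ℚ v u +ℚ (sumQ (allQ n) (adjDiff v u) -ℚ d *ℚ v u)
      ≡⟨ solve 2 (λ a s → a :+ (s :- a) := s) refl (d *ℚ v u) (sumQ (allQ n) (adjDiff v u)) ⟩
    sumQ (allQ n) (adjDiff v u) ∎
    where
    open ≡-Reasoning
    d = fromℕ (degree u)
    sum-diagPart : sumQ (allQ n) (diagPart v u) ≡ d *ℚ v u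
    sum-diagPart = trans (sumAll-delta n u (diagPart v u) off-diagonal)
                         (cong (if_then d *ℚ v u else 0ℚ) (dec-true (_≟Q_ {n} u u) refl))
      where
      off-diagonal : ∀ w → w ≢ u → diagPart v u w ≡ 0ℚ
      off-diagonal w w≢u = cong (if_then d *ℚ v u else 0ℚ) (dec-false (_≟Q_ {n} u w) (≢-sym w≢u))
    sum-adjPart : sumQ (allQ n) (adjPart v u) ≡ d *ℚ v u
    sum-adjPart = begin
      sumQ (allQ n) (adjPart v u)
        ≡⟨ sumQ-cong (allQ n) indicator ⟩
      sumQ (allQ n) (λ w → (if does (adj? u w) then 1ℚ else 0ℚ) *ℚ v u)
        ≡⟨ sumQ-*ʳ (allQ n) (v u) (λ w → if does (adj? u w) then 1ℚ else 0ℚ) ⟩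
      sumQ (allQ n) (λ w → if does (adj? u w) then 1ℚ else 0ℚ) *ℚ v u
        ≡⟨ cong (_*ℚ v u) (sumQ-length-filter (adj? u) (allQ n)) ⟨
      d *ℚ v u ∎
      where
      indicator : ∀ w → adjPart v u w ≡ (if does (adj? u w) then 1ℚ else 0ℚ) *ℚ v u
      indicator w with does (adj? u w)
      ... | true  = sym (*-identityˡ (v u))
      ... | false = sym (*-zeroˡ (v u))

  adjDiff-antisym : ∀ v u w → adjDiff v w u ≡ -ℚ adjDiff v u w
  adjDiff-antisym v u w with adj? w u | adj? u w
  ... | yes _   | yes _   = solve 2 (λ x y → y :- x := :- (x :- y)) refl (v u) (v w)
  ... | no _    | no _    = refl
  ... | yes w~u | no ¬u~w = contradiction (PowerAdj-sym w~u) ¬u~w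
  ... | no ¬w~u | yes u~w = contradiction (PowerAdj-sym u~w) ¬w~u

  sum-applyL≡0 : ∀ v → sumQ (allQ n) (applyL v) ≡ 0ℚ
  sum-applyL≡0 v = trans (sumQ-cong (allQ n) (applyL≡sum-adjDiff v)) (self-negating S S≡-S)
    where
    S = sumQ (allQ n) (λ u → sumQ (allQ n) (adjDiff v u))
    S≡-S : S ≡ -ℚ S
    S≡-S = begin
      S                                                          ≡⟨ sumQ-swap (allQ n) (allQ n) (adjDiff v) ⟩
      sumQ (allQ n) (λ w → sumQ (allQ n) (λ u → adjDiff v u w))
        ≡⟨ sumQ-cong (allQ n) (λ w → sumQ-cong (allQ n) (λ u → adjDiff-antisym v w u)) ⟩
      sumQ (allQ n) (λ w → sumQ (allQ n) (λ u → -ℚ adjDiff v w u))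
        ≡⟨ sumQ-cong (allQ n) (λ w → sumQ-neg (allQ n) (adjDiff v w)) ⟩
      sumQ (allQ n) (λ w → -ℚ sumQ (allQ n) (adjDiff v w))      ≡⟨ sumQ-neg (allQ n) (λ w → sumQ (allQ n) (adjDiff v w)) ⟩
      -ℚ S                                                       ∎
      where open ≡-Reasoning
    self-negating : ∀ x → x ≡ -ℚ x → x ≡ 0ℚ
    self-negating x x≡-x = *-cancelˡ-≡0 (fromℕ 2) x (fromℕ≢0 2)
      (trans (solve 1 (λ x → con (fromℕ 2) :* x := x :- (:- x)) refl x)
             (trans (cong (λ y → x -ℚ y) (sym x≡-x)) (+-inverseʳ x)))

  ν : ℚ
  ν = fromℕ (4 * n)

  nonAdjDiff : (Q n → ℚ) → Q n → Q n → ℚ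
  nonAdjDiff v u w = if does (adj? u w) then 0ℚ else v u -ℚ v w

  module OrderEigenvector (ν≢0 : ν ≢ 0ℚ) (v : Q n → ℚ) (eigen : InEigenspace n L ν v) where

    eigen-sum≡0 : sumQ (allQ n) v ≡ 0ℚ
    eigen-sum≡0 = *-cancelˡ-≡0 ν _ ν≢0 (begin
      ν *ℚ sumQ (allQ n) v              ≡⟨ sumQ-*ˡ (allQ n) ν v ⟨
      sumQ (allQ n) (λ u → ν *ℚ v u)    ≡⟨ sumQ-cong (allQ n) (λ u → sym (eigen u)) ⟩
      sumQ (allQ n) (applyL v)          ≡⟨ sum-applyL≡0 v ⟩
      0ℚ                                ∎)
      where open ≡-Reasoning

    nonAdj-balance : ∀ u → sumQ (allQ n) (nonAdjDiff v u) ≡ 0ℚ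
    nonAdj-balance u = cancel (begin
      sumQ (allQ n) (nonAdjDiff v u) +ℚ sumQ (allQ n) (adjDiff v u)
        ≡⟨ sumQ-+ (allQ n) (nonAdjDiff v u) (adjDiff v u) ⟨
      sumQ (allQ n) (λ w → nonAdjDiff v u w +ℚ adjDiff v u w)
        ≡⟨ sumQ-cong (allQ n) split ⟩
      sumQ (allQ n) (λ w → v u -ℚ v w)
        ≡⟨ sumQ-- (allQ n) (λ _ → v u) v ⟩
      sumQ (allQ n) (λ _ → v u) -ℚ sumQ (allQ n) v
        ≡⟨ cong₂ _-ℚ_ (sumAll-const n (v u)) eigen-sum≡0 ⟩
      ν *ℚ v u -ℚ 0ℚ
        ≡⟨ solve 1 (λ x → x :- con 0ℚ := x) refl (ν *ℚ v u) ⟩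
      ν *ℚ v u
        ≡⟨ eigen u ⟨
      applyL v u
        ≡⟨ applyL≡sum-adjDiff v u ⟩
      sumQ (allQ n) (adjDiff v u) ∎)
      where
      open ≡-Reasoning
      split : ∀ w → nonAdjDiff v u w +ℚ adjDiff v u w ≡ v u -ℚ v w
      split w = if-0-+-if-0 (does (adj? u w)) (v u -ℚ v w)
      cancel : ∀ {a b} → a +ℚ b ≡ b → a ≡ 0ℚ
      cancel {a} {b} a+b≡b = trans (solve 2 (λ a b → a := (a :+ b) :- b) refl a b)
                                   (trans (cong (_-ℚ b) a+b≡b) (+-inverseʳ b))

    -- At a maximum x of v on R every term of nonAdj-balance x is nonnegative, hence zero:
    -- maxima propagate to non-neighbours, and so along paths of the complement graph.
    module _ (R : Q n → Set) (R? : ∀ u → Dec (R u)) (R-closed : ∀ {u w} → R u → NonAdj n u w → R w)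
             (b : Q n) (Rb : R b) (reach : ∀ u → R u → Star (NonAdj n) u b) where

      private
        m : Q n
        m = argmax v b (filter R? (allQ n))

        Rm : R m
        Rm = argmax-all v Rb (AllP.all-filter R? (allQ n))

        v≤v[m] : ∀ z → R z → v z ≤ℚ v m
        v≤v[m] z Rz = All.lookup (f[xs]≤f[argmax] b (filter R? (allQ n)))
                                 (MemP.∈-filter⁺ R? (∈-allQ n z) Rz)

        Maximal : Q n → Set
        Maximal x = R x × v x ≡ v m

        spread : ∀ {x y} → Maximal x → NonAdj n x y → Maximal y
        spread {x} {y} (Rx , vx≡vm) x≁y = R-closed Rx x≁y , trans vy≡vx vx≡vm
          where
          nonneg : ∀ w → 0ℚ ≤ℚ nonAdjDiff v x w
          nonneg w = if-0-nonneg (adj? x w) (λ x≁w → subst (_≤ℚ v x -ℚ v w) (+-inverseʳ (v w))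
                       (+-monoˡ-≤ (-ℚ v w) (subst (v w ≤ℚ_) (sym vx≡vm) (v≤v[m] w (R-closed Rx x≁w)))))
          vy≡vx : v y ≡ v x
          vy≡vx = sym (p-q≡0⇒p≡q (v x) (v y)
            (trans (cong (if_then 0ℚ else v x -ℚ v y) (sym (dec-false (adj? x y) x≁y)))
                   (sumQ-nonneg-≡0 (allQ n) (nonAdjDiff v x) nonneg (nonAdj-balance x) (∈-allQ n y))))

        spread-along : ∀ {x y} → Star (NonAdj n) x y → Maximal x → Maximal y
        spread-along ε             max-x = max-x
        spread-along (x≁y ◅ path) max-x = spread-along path (spread max-x x≁y)

      constant-on : ∀ u → R u → v u ≡ v b
      constant-on u Ru = trans (proj₂ u-maximal) (sym (proj₂ b-maximal))
        where
        b-maximal = spread-along (reach m Rm) (Rm , refl)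
        u-maximal = spread-along (reverse NonAdj-sym (reach u Ru)) b-maximal

  δ : Q n → Q n → ℚ
  δ x u = if does (_≟Q_ {n} u x) then 1ℚ else 0ℚ

  δ-self : ∀ x → δ x x ≡ 1ℚ
  δ-self x = cong (if_then 1ℚ else 0ℚ) (dec-true (_≟Q_ {n} x x) refl)

  δ-off : ∀ {x u} → u ≢ x → δ x u ≡ 0ℚ
  δ-off {x} {u} u≢x = cong (if_then 1ℚ else 0ℚ) (dec-false (_≟Q_ {n} u x) u≢x)

  sum-δ : ∀ x → sumQ (allQ n) (δ x) ≡ 1ℚ
  sum-δ x = trans (sumAll-delta n x (δ x) (λ _ → δ-off)) (δ-self x)

  domVector : Q n → Q n → ℚ
  domVector x u = ν *ℚ δ x u -ℚ 1ℚ

  applyL-δ : ∀ {x} → Dominating n x → ∀ u → sumQ (allQ n) (adjDiff (δ x) u) ≡ domVector x u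
  applyL-δ {x} x-dom = at-or-off {n} x at-x off-x
    where
    open ≡-Reasoning
    at-x : sumQ (allQ n) (adjDiff (δ x) x) ≡ domVector x x
    at-x = begin
      sumQ (allQ n) (adjDiff (δ x) x)                  ≡⟨ sumQ-cong (allQ n) term ⟩
      sumQ (allQ n) (λ w → 1ℚ -ℚ δ x w)                ≡⟨ sumQ-- (allQ n) (λ _ → 1ℚ) (δ x) ⟩
      sumQ (allQ n) (λ _ → 1ℚ) -ℚ sumQ (allQ n) (δ x)  ≡⟨ cong₂ _-ℚ_ (sumAll-const n 1ℚ) (sum-δ x) ⟩
      ν *ℚ 1ℚ -ℚ 1ℚ                                    ≡⟨ cong (λ d → ν *ℚ d -ℚ 1ℚ) (δ-self x) ⟨
      domVector x x                                    ∎
      where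
      term : ∀ w → adjDiff (δ x) x w ≡ 1ℚ -ℚ δ x w
      term w rewrite δ-self x with _≟Q_ {n} w x | adj? x w
      ... | yes refl | yes (x≢x , _) = contradiction refl x≢x
      ... | yes refl | no _          = solve 0 (con 0ℚ := con 1ℚ :- con 1ℚ) refl
      ... | no _     | yes _         = refl
      ... | no w≢x   | no x≁w        = contradiction (PowerAdj-sym (x-dom w w≢x)) x≁w
    off-x : ∀ u → u ≢ x → sumQ (allQ n) (adjDiff (δ x) u) ≡ domVector x u
    off-x u u≢x = begin
      sumQ (allQ n) (adjDiff (δ x) u)  ≡⟨ sumQ-cong (allQ n) term ⟩
      sumQ (allQ n) (λ w → -ℚ δ x w)   ≡⟨ sumQ-neg (allQ n) (δ x) ⟩
      -ℚ sumQ (allQ n) (δ x)           ≡⟨ cong -ℚ_ (sum-δ x) ⟩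
      -ℚ 1ℚ                            ≡⟨ solve 1 (λ ν → :- con 1ℚ := ν :* con 0ℚ :- con 1ℚ) refl ν ⟩
      ν *ℚ 0ℚ -ℚ 1ℚ                    ≡⟨ cong (λ d → ν *ℚ d -ℚ 1ℚ) (δ-off u≢x) ⟨
      domVector x u                    ∎
      where
      term : ∀ w → adjDiff (δ x) u w ≡ -ℚ δ x w
      term w rewrite δ-off u≢x with _≟Q_ {n} w x | adj? u w
      ... | yes refl | yes _  = solve 0 (con 0ℚ :- con 1ℚ := :- con 1ℚ) refl
      ... | yes refl | no u≁x = contradiction (x-dom u u≢x) u≁x
      ... | no _     | yes _  = solve 0 (con 0ℚ :- con 0ℚ := :- con 0ℚ) refl
      ... | no _     | no _   = refl

  domVector-eigen : ∀ {x} → Dominating n x → InEigenspace n L ν (domVector x)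
  domVector-eigen {x} x-dom u = begin
    applyL (domVector x) u                         ≡⟨ applyL≡sum-adjDiff (domVector x) u ⟩
    sumQ (allQ n) (adjDiff (domVector x) u)        ≡⟨ sumQ-cong (allQ n) scale ⟩
    sumQ (allQ n) (λ w → ν *ℚ adjDiff (δ x) u w)   ≡⟨ sumQ-*ˡ (allQ n) ν (adjDiff (δ x) u) ⟩
    ν *ℚ sumQ (allQ n) (adjDiff (δ x) u)           ≡⟨ cong (ν *ℚ_) (applyL-δ x-dom u) ⟩
    ν *ℚ domVector x u                             ∎
    where
    open ≡-Reasoning
    scale : ∀ w → adjDiff (domVector x) u w ≡ ν *ℚ adjDiff (δ x) u w
    scale w = if-0-scale (does (adj? u w)) ν
      (solve 3 (λ ν a b → (ν :* a :- con 1ℚ) :- (ν :* b :- con 1ℚ) := ν :* (a :- b)) refl ν (δ x u) (δ x w))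

  module DominatingFamily {k} (ν≢0 : ν ≢ 0ℚ) (D : Fin k → Q n) (D-injective : ∀ {i j} → D i ≡ D j → i ≡ j)
                          (D-dominating : ∀ i → Dominating n (D i)) (b : Q n) (b∉D : ¬ ∃ λ i → b ≡ D i)
                          where

    domVectors : Fin k → Q n → ℚ
    domVectors i = domVector (D i)

    domVectors-eigen : ∀ i → InEigenspace n L ν (domVectors i)
    domVectors-eigen i = domVector-eigen (D-dominating i)

    -- Evaluating a relation at D j and at b and subtracting isolates ν c_j.
    domVectors-independent : LinIndep n k domVectors
    domVectors-independent c relation j = *-cancelˡ-≡0 ν (c j) ν≢0 (begin
      ν *ℚ c j
        ≡⟨ solve 2 (λ ν c → ν :* c := ν :* (c :* con 1ℚ)) refl ν (c j) ⟩
      ν *ℚ (c j *ℚ 1ℚ)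
        ≡⟨ cong (λ d → ν *ℚ (c j *ℚ d)) (δ-self (D j)) ⟨
      ν *ℚ (c j *ℚ δ (D j) (D j))
        ≡⟨ sumQ-delta (allFin k) (λ i → ν *ℚ (c i *ℚ δ (D i) (D j))) (UniqueP.allFin⁺ k) (MemP.∈-allFin j) off-j ⟨
      sumFin k (λ i → ν *ℚ (c i *ℚ δ (D i) (D j)))
        ≡⟨ sumQ-cong (allFin k) difference ⟨
      sumFin k (λ i → c i *ℚ domVectors i (D j) -ℚ c i *ℚ domVectors i b)
        ≡⟨ sumQ-- (allFin k) (λ i → c i *ℚ domVectors i (D j)) (λ i → c i *ℚ domVectors i b) ⟩
      lincomb n domVectors c (D j) -ℚ lincomb n domVectors c b
        ≡⟨ cong₂ _-ℚ_ (relation (D j)) (relation b) ⟩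
      0ℚ -ℚ 0ℚ
        ≡⟨ +-inverseʳ 0ℚ ⟩
      0ℚ ∎)
      where
      open ≡-Reasoning
      off-j : ∀ i → i ≢ j → ν *ℚ (c i *ℚ δ (D i) (D j)) ≡ 0ℚ
      off-j i i≢j = trans (cong (λ d → ν *ℚ (c i *ℚ d)) (δ-off (λ Dj≡Di → i≢j (sym (D-injective Dj≡Di)))))
                          (solve 2 (λ ν c → ν :* (c :* con 0ℚ) := con 0ℚ) refl ν (c i))
      difference : ∀ i → c i *ℚ domVectors i (D j) -ℚ c i *ℚ domVectors i b ≡ ν *ℚ (c i *ℚ δ (D i) (D j))
      difference i = trans (cong (λ d → c i *ℚ domVectors i (D j) -ℚ c i *ℚ (ν *ℚ d -ℚ 1ℚ))
                                 (δ-off (λ b≡Di → b∉D (i , b≡Di))))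
                           (solve 3 (λ ν c d → c :* (ν :* d :- con 1ℚ) :- c :* (ν :* con 0ℚ :- con 1ℚ) := ν :* (c :* d))
                              refl ν (c i) (δ (D i) (D j)))

    module _ (reach : ∀ u → ¬ (∃ λ i → u ≡ D i) → Star (NonAdj n) u b) where

      private
        Outside : Q n → Set
        Outside u = ¬ ∃ λ i → u ≡ D i

        outside? : ∀ u → Dec (Outside u)
        outside? u = ¬? (FinP.any? (λ i → _≟Q_ {n} u (D i)))

        outside-closed : ∀ {u w} → Outside u → NonAdj n u w → Outside w
        outside-closed u∉D u≁w (i , refl) = u≁w (D-dominating i _ (λ u≡Di → u∉D (i , u≡Di)))

      -- By the maximum principle v is constant (= v b = 0) off D, and Σ v = 0 then forces v (D i₀) = 0.
      eigen-vanishing : ∀ v → InEigenspace n L ν v → v b ≡ 0ℚ → ∀ i₀ → (∀ i → i ≢ i₀ → v (D i) ≡ 0ℚ) →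
                        ∀ u → v u ≡ 0ℚ
      eigen-vanishing v eigen vb≡0 i₀ v[D]≡0 = at-or-off {n} (D i₀) at-D₀ off-D₀
        where
        open OrderEigenvector ν≢0 v eigen
        off-D₀ : ∀ u → u ≢ D i₀ → v u ≡ 0ℚ
        off-D₀ u u≢D₀ = [ (λ (i , u≡Dᵢ) → trans (cong v u≡Dᵢ) (v[D]≡0 i (λ i≡i₀ → u≢D₀ (trans u≡Dᵢ (cong D i≡i₀)))))
                        , (λ u∉D → trans (constant-on Outside outside? outside-closed b b∉D reach u u∉D) vb≡0)
                        ]′ (toSum (FinP.any? (λ i → _≟Q_ {n} u (D i))))
        at-D₀ : v (D i₀) ≡ 0ℚ
        at-D₀ = trans (sym (sumAll-delta n (D i₀) v off-D₀)) eigen-sum≡0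

      ¬LinIndep-eigenvectors : ∀ {m} (w : Fin m → Q n → ℚ) → (∀ j → InEigenspace n L ν (w j)) →
                               ∀ c → Nontrivial c → lincomb n w c b ≡ 0ℚ →
                               ∀ i₀ → (∀ i → i ≢ i₀ → lincomb n w c (D i) ≡ 0ℚ) → ¬ LinIndep n m w
      ¬LinIndep-eigenvectors w eigen c (j , cⱼ≢0) at-b i₀ at-D independent =
        cⱼ≢0 (independent c (eigen-vanishing (lincomb n w c) (lincomb-InEigenspace {n} L ν w c eigen) at-b i₀ at-D) j)

-- Powers of two

parity : ∀ i → ∃[ q ] (i ≡ q + q ⊎ i ≡ suc (q + q))
parity zero = 0 , inj₁ refl
parity (suc i) with parity i
... | q , inj₁ i≡2q   = q , inj₂ (cong suc i≡2q)
... | q , inj₂ i≡2q+1 = suc q , inj₁ (cong suc (trans i≡2q+1 (sym (ℕP.+-suc q q))))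

two-adic : ∀ i → 0 < i → ∃[ s ] ∃[ q ] i ≡ 2 ^ s * suc (q + q)
two-adic = <-rec (λ i → 0 < i → ∃[ s ] ∃[ q ] i ≡ 2 ^ s * suc (q + q)) decompose
  where
  decompose : ∀ i → (∀ {j} → j < i → 0 < j → ∃[ s ] ∃[ q ] j ≡ 2 ^ s * suc (q + q)) →
              0 < i → ∃[ s ] ∃[ q ] i ≡ 2 ^ s * suc (q + q)
  decompose i rec 0<i with parity i
  ... | q , inj₂ i≡2q+1 = 0 , q , trans i≡2q+1 (sym (ℕP.+-identityʳ _))
  ... | zero  , inj₁ refl = contradiction 0<i (λ ())
  ... | suc h , inj₁ refl with rec (ℕP.m<m+n (suc h) (s≤s z≤n)) (s≤s z≤n)
  ...   | s , q , h≡2ˢo = suc s , q , trans (cong₂ _+_ h≡2ˢo h≡2ˢo) (double (2 ^ s) q)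
    where
    double : ∀ p q → p * suc (q + q) + p * suc (q + q) ≡ 2 * p * suc (q + q)
    double = solve-∀

-- i · 2^(t-s) = 2^t · odd when i = 2^s · odd with s ≤ t.
odd-multiple-of-power-of-two : ∀ t i → 0 < i → i < 2 * 2 ^ t →
                               ∃[ c ] ∃[ q ] i * suc c ≡ 2 ^ t + q * (2 * 2 ^ t)
odd-multiple-of-power-of-two t i 0<i i<2ᵗ⁺¹ with two-adic i 0<i
... | s , q , i≡2ˢo with s ℕ.≤? t
...   | no s≰t  = contradiction i<2ᵗ⁺¹ (ℕP.≤⇒≯ (ℕP.≤-trans (ℕP.^-monoʳ-≤ 2 (ℕP.≰⇒> s≰t))
                    (subst (2 ^ s ≤_) (sym i≡2ˢo) (ℕP.m≤m*n (2 ^ s) (suc (q + q))))))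
...   | yes s≤t with 2 ^ (t ∸ s) | ℕP.m^n>0 2 (t ∸ s) | ℕP.^-distribˡ-+-* 2 s (t ∸ s)
...     | suc c | _ | 2ᵗ≡2ˢ2ᵗ⁻ˢ = c , q , (begin
  i * suc c                                   ≡⟨ cong (_* suc c) i≡2ˢo ⟩
  2 ^ s * suc (q + q) * suc c                 ≡⟨ rearrange (2 ^ s) (suc c) q ⟩
  2 ^ s * suc c + q * (2 * (2 ^ s * suc c))   ≡⟨ cong (λ x → x + q * (2 * x)) 2ˢ2ᵗ⁻ˢ≡2ᵗ ⟩
  2 ^ t + q * (2 * 2 ^ t)                     ∎)
  where
  open ≡-Reasoning
  rearrange : ∀ p c q → p * suc (q + q) * c ≡ p * c + q * (2 * (p * c))
  rearrange = solve-∀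
  2ˢ2ᵗ⁻ˢ≡2ᵗ : 2 ^ s * suc c ≡ 2 ^ t
  2ˢ2ᵗ⁻ˢ≡2ᵗ = trans (sym 2ᵗ≡2ˢ2ᵗ⁻ˢ) (cong (2 ^_) (ℕP.m+[n∸m]≡n s≤t))

2∤odd : ∀ q → ¬ 2 ∣ suc (q + q)
2∤odd q 2∣odd = contradiction (trans (sym odd%2≡1) (n∣m⇒m%n≡0 (suc (q + q)) 2 2∣odd)) (λ ())
  where
  odd%2≡1 : suc (q + q) % 2 ≡ 1
  odd%2≡1 = trans (cong (λ x → suc x % 2) (trans (cong (λ m → q + m) (sym (ℕP.+-identityʳ q))) (ℕP.*-comm 2 q))) (DM.[m+kn]%n≡m%n 1 q 2)

-- The dicyclic group Q_n for n = k + 2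

module Dicyclic (k : ℕ) where

  n N : ℕ
  n = suc (suc k)
  N = 2 * n

  -- A record rather than x % N ≡ y % N, so that Agda can infer x and y from a proof.
  infix 4 _≡N_
  record _≡N_ (x y : ℕ) : Set where
    constructor mod-≡
    field %N-≡ : x % N ≡ y % N
  open _≡N_

  ≡N-isEquivalence : IsEquivalence _≡N_
  ≡N-isEquivalence = record
    { refl  = mod-≡ refl
    ; sym   = λ x≡y → mod-≡ (sym (%N-≡ x≡y))
    ; trans = λ x≡y y≡z → mod-≡ (trans (%N-≡ x≡y) (%N-≡ y≡z))
    }

  ≡N-setoid : Setoid 0ℓ 0ℓ
  ≡N-setoid = record { isEquivalence = ≡N-isEquivalence }

  module ≡N-Reasoning = SetoidReasoning ≡N-setoid

  open IsEquivalence ≡N-isEquivalence using () renaming (refl to ≡N-refl; sym to ≡N-sym; trans to ≡N-trans)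

  [_] : ℕ → Fin N
  [ x ] = x mod N

  toℕ-[]≡% : ∀ x → toℕ [ x ] ≡ x % N
  toℕ-[]≡% x = FinP.toℕ-fromℕ< (DM.m%n<n x N)

  toℕ-[] : ∀ x → toℕ [ x ] ≡N x
  toℕ-[] x = mod-≡ (trans (cong (_% N) (toℕ-[]≡% x)) (DM.m%n%n≡m%n x N))

  toℕ-[]-< : ∀ {x} → x < N → toℕ [ x ] ≡ x
  toℕ-[]-< {x} x<N = trans (toℕ-[]≡% x) (DM.m<n⇒m%n≡m x<N)

  ≡N-+ : ∀ {a b c d} → a ≡N b → c ≡N d → a + c ≡N b + d
  ≡N-+ {a} {b} {c} {d} (mod-≡ a≡b) (mod-≡ c≡d) = mod-≡
    (trans (DM.%-distribˡ-+ a c N) (trans (cong₂ (λ x y → (x + y) % N) a≡b c≡d) (sym (DM.%-distribˡ-+ b d N))))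

  ≡N-<⇒≡ : ∀ {x y} → x < N → y < N → x ≡N y → x ≡ y
  ≡N-<⇒≡ x<N y<N (mod-≡ x≡y) = trans (sym (DM.m<n⇒m%n≡m x<N)) (trans x≡y (DM.m<n⇒m%n≡m y<N))

  toℕ-injective-mod : ∀ {i j : Fin N} → toℕ i ≡N toℕ j → i ≡ j
  toℕ-injective-mod {i} {j} i≡j = FinP.toℕ-injective (≡N-<⇒≡ (FinP.toℕ<n i) (FinP.toℕ<n j) i≡j)

  +N : ∀ x → x + N ≡N x
  +N x = mod-≡ (DM.[m+n]%n≡m%n x N)

  i+[N∸i] : ∀ (i : Fin N) → toℕ i + (N ∸ toℕ i) ≡ N
  i+[N∸i] i = ℕP.m+[n∸m]≡n (ℕP.<⇒≤ (FinP.toℕ<n i))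

  n<N : n < N
  n<N = ℕP.m<m+n n {n + 0} (s≤s z≤n)

  N≡n+n : N ≡ n + n
  N≡n+n = cong (λ m → n + m) (ℕP.+-identityʳ n)

  toℕ-addMod : ∀ (i j : Fin N) → toℕ (addMod i j) ≡N toℕ i + toℕ j
  toℕ-addMod i j = toℕ-[] (toℕ i + toℕ j)

  toℕ-addNat : ∀ (i : Fin N) m → toℕ (addNat i m) ≡N toℕ i + m
  toℕ-addNat i m = toℕ-[] (toℕ i + m)

  toℕ-negMod : ∀ (i : Fin N) → toℕ i + toℕ (negMod i) ≡N 0
  toℕ-negMod i = begin
    toℕ i + toℕ [ N ∸ toℕ i ]  ≈⟨ ≡N-+ (≡N-refl {toℕ i}) (toℕ-[] (N ∸ toℕ i)) ⟩
    toℕ i + (N ∸ toℕ i)        ≡⟨ i+[N∸i] i ⟩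
    N                          ≈⟨ +N 0 ⟩
    0                          ∎
    where open ≡N-Reasoning

  e aⁿ b : Q n
  e  = Fin.zero , false
  aⁿ = [ n ] , false
  b  = Fin.zero , true

  toℕ-[n] : toℕ [ n ] ≡ n
  toℕ-[n] = toℕ-[]-< n<N

  rotation-power : ∀ i m → powQ n (i , false) m ≡ ([ toℕ i * suc m ] , false)
  rotation-power i zero = cong (_, false) (toℕ-injective-mod (begin
    toℕ i                ≡⟨ ℕP.*-identityʳ (toℕ i) ⟨
    toℕ i * 1            ≈⟨ toℕ-[] (toℕ i * 1) ⟨
    toℕ [ toℕ i * 1 ]    ∎))
    where open ≡N-Reasoning
  rotation-power i (suc m) rewrite rotation-power i m = cong (_, false) (toℕ-injective-mod (begin
    toℕ (addMod [ toℕ i * suc m ] i)  ≈⟨ toℕ-addMod [ toℕ i * suc m ] i ⟩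
    toℕ [ toℕ i * suc m ] + toℕ i   ≈⟨ ≡N-+ (toℕ-[] (toℕ i * suc m)) (≡N-refl {toℕ i}) ⟩
    toℕ i * suc m + toℕ i           ≡⟨ trans (ℕP.+-comm _ (toℕ i)) (sym (ℕP.*-suc (toℕ i) (suc m))) ⟩
    toℕ i * suc (suc m)             ≈⟨ toℕ-[] (toℕ i * suc (suc m)) ⟨
    toℕ [ toℕ i * suc (suc m) ]     ∎))
    where open ≡N-Reasoning

  e≢aⁿ : e ≢ aⁿ
  e≢aⁿ e≡aⁿ = case trans (cong (toℕ ∘ proj₁) e≡aⁿ) toℕ-[n] of λ ()

  reflection² : ∀ i → mulQ n (i , true) (i , true) ≡ aⁿ
  reflection² i = cong (_, false) (toℕ-injective-mod (begin
    toℕ (addNat (addMod i (negMod i)) n)  ≈⟨ toℕ-addNat (addMod i (negMod i)) n ⟩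
    toℕ (addMod i (negMod i)) + n         ≈⟨ ≡N-+ (≡N-trans (toℕ-addMod i (negMod i)) (toℕ-negMod i)) (≡N-refl {n}) ⟩
    n                                     ≈⟨ toℕ-[] n ⟨
    toℕ [ n ]                             ∎))
    where open ≡N-Reasoning

  aⁿ·reflection : ∀ i → mulQ n aⁿ (i , true) ≡ ([ n + toℕ i ] , true)
  aⁿ·reflection i = cong (_, true) (toℕ-injective-mod (begin
    toℕ (addMod [ n ] i)   ≈⟨ toℕ-addMod [ n ] i ⟩
    toℕ [ n ] + toℕ i      ≡⟨ cong (_+ toℕ i) toℕ-[n] ⟩
    n + toℕ i              ≈⟨ toℕ-[] (n + toℕ i) ⟨
    toℕ [ n + toℕ i ]      ∎))
    where open ≡N-Reasoning

  reflection³·reflection : ∀ i → mulQ n ([ n + toℕ i ] , true) (i , true) ≡ e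
  reflection³·reflection i = cong (_, false) (toℕ-injective-mod (begin
    toℕ (addNat (addMod [ n + toℕ i ] (negMod i)) n)  ≈⟨ toℕ-addNat (addMod [ n + toℕ i ] (negMod i)) n ⟩
    toℕ (addMod [ n + toℕ i ] (negMod i)) + n
      ≈⟨ ≡N-+ (≡N-trans (toℕ-addMod [ n + toℕ i ] (negMod i)) (≡N-+ (toℕ-[] (n + toℕ i)) (≡N-refl {toℕ (negMod i)}))) (≡N-refl {n}) ⟩
    n + toℕ i + toℕ (negMod i) + n                    ≡⟨ cong (_+ n) (ℕP.+-assoc n (toℕ i) _) ⟩
    n + (toℕ i + toℕ (negMod i)) + n                  ≈⟨ ≡N-+ (≡N-+ (≡N-refl {n}) (toℕ-negMod i)) (≡N-refl {n}) ⟩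
    n + 0 + n                                         ≡⟨ cong (_+ n) (ℕP.+-identityʳ n) ⟩
    n + n                                             ≡⟨ N≡n+n ⟨
    N                                                 ≈⟨ +N 0 ⟩
    0                                                 ∎))
    where open ≡N-Reasoning

  e·reflection : ∀ i → mulQ n e (i , true) ≡ (i , true)
  e·reflection i = cong (_, true) (toℕ-injective-mod (toℕ-addMod Fin.zero i))

  data ReflectionPower (i : Fin N) (x : Q n) : Set where
    itself   : x ≡ (i , true) → ReflectionPower i x
    square   : x ≡ aⁿ → ReflectionPower i x
    cube     : x ≡ ([ n + toℕ i ] , true) → ReflectionPower i x
    identity : x ≡ e → ReflectionPower i x

  reflection-power : ∀ i m → ReflectionPower i (powQ n (i , true) m)
  reflection-power i zero = itself refl
  reflection-power i (suc m) with reflection-power i m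
  ... | itself x≡r  = square   (trans (cong (λ x → mulQ n x (i , true)) x≡r) (reflection² i))
  ... | square x≡aⁿ = cube     (trans (cong (λ x → mulQ n x (i , true)) x≡aⁿ) (aⁿ·reflection i))
  ... | cube x≡r³   = identity (trans (cong (λ x → mulQ n x (i , true)) x≡r³) (reflection³·reflection i))
  ... | identity x≡e = itself  (trans (cong (λ x → mulQ n x (i , true)) x≡e) (e·reflection i))

  reflection⁴≡e : ∀ i → powQ n (i , true) 3 ≡ e
  reflection⁴≡e i = begin
    mulQ n (mulQ n (mulQ n r r) r) r   ≡⟨ cong (λ x → mulQ n (mulQ n x r) r) (reflection² i) ⟩
    mulQ n (mulQ n aⁿ r) r             ≡⟨ cong (λ x → mulQ n x r) (aⁿ·reflection i) ⟩
    mulQ n ([ n + toℕ i ] , true) r    ≡⟨ reflection³·reflection i ⟩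
    e                                  ∎
    where
    open ≡-Reasoning
    r = (i , true)

  e-dominating : Dominating n e
  e-dominating (i , true)  w≢e = w≢e , 3 , inj₁ (sym (reflection⁴≡e i))
  e-dominating (i , false) w≢e = w≢e , ℕ.pred N , inj₁ (sym (trans (rotation-power i (ℕ.pred N))
    (cong (_, false) (toℕ-injective-mod (≡N-trans (toℕ-[] (toℕ i * N)) (mod-≡ (DM.m*n%n≡0 (toℕ i) N)))))))

  +n-involutive : ∀ {x y} → x ≡N n + y → y ≡N n + x
  +n-involutive {x} {y} x≡n+y = begin
    y                ≈⟨ +N y ⟨
    y + N            ≡⟨ cong (λ m → y + m) N≡n+n ⟩
    y + (n + n)      ≡⟨ solve-+ y n ⟩
    (n + y) + n      ≈⟨ ≡N-+ (≡N-sym x≡n+y) (≡N-refl {n}) ⟩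
    x + n            ≡⟨ ℕP.+-comm x n ⟩
    n + x            ∎
    where
    open ≡N-Reasoning
    solve-+ : ∀ y n → y + (n + n) ≡ (n + y) + n
    solve-+ = solve-∀

  reflections-nonadj : ∀ i j → toℕ j ≢ toℕ i → ¬ (toℕ j ≡N n + toℕ i) → NonAdj n (i , true) (j , true)
  reflections-nonadj i j j≢i j≢n+i (_ , m , inj₁ rⱼ≡rᵢᵐ) with reflection-power i m
  ... | itself x≡rᵢ = j≢i (cong (toℕ ∘ proj₁) (trans rⱼ≡rᵢᵐ x≡rᵢ))
  ... | square x≡aⁿ = case trans rⱼ≡rᵢᵐ x≡aⁿ of λ ()
  ... | cube x≡r³   = j≢n+i (≡N-trans (mod-≡ (cong (λ x → toℕ (proj₁ x) % N) (trans rⱼ≡rᵢᵐ x≡r³))) (toℕ-[] (n + toℕ i)))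
  ... | identity x≡e = case trans rⱼ≡rᵢᵐ x≡e of λ ()
  reflections-nonadj i j j≢i j≢n+i (_ , m , inj₂ rᵢ≡rⱼᵐ) with reflection-power j m
  ... | itself x≡rⱼ = j≢i (cong (toℕ ∘ proj₁) (sym (trans rᵢ≡rⱼᵐ x≡rⱼ)))
  ... | square x≡aⁿ = case trans rᵢ≡rⱼᵐ x≡aⁿ of λ ()
  ... | cube x≡r³   = j≢n+i (+n-involutive (≡N-trans (mod-≡ (cong (λ x → toℕ (proj₁ x) % N) (trans rᵢ≡rⱼᵐ x≡r³)))
                                                     (toℕ-[] (n + toℕ j))))
  ... | identity x≡e = case trans rᵢ≡rⱼᵐ x≡e of λ ()

  rotation-b-nonadj : ∀ i → toℕ i ≢ 0 → toℕ i ≢ n → NonAdj n (i , false) b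
  rotation-b-nonadj i i≢0 i≢n (_ , m , inj₁ b≡aⁱᵐ) = case trans b≡aⁱᵐ (rotation-power i m) of λ ()
  rotation-b-nonadj i i≢0 i≢n (_ , m , inj₂ aⁱ≡bᵐ) with reflection-power Fin.zero m
  ... | itself x≡b   = case trans aⁱ≡bᵐ x≡b of λ ()
  ... | square x≡aⁿ  = i≢n (trans (cong (toℕ ∘ proj₁) (trans aⁱ≡bᵐ x≡aⁿ)) toℕ-[n])
  ... | cube x≡r³    = case trans aⁱ≡bᵐ x≡r³ of λ ()
  ... | identity x≡e = i≢0 (cong (toℕ ∘ proj₁) (trans aⁱ≡bᵐ x≡e))

  ≢N-< : ∀ {x y} → x < N → y < N → x ≢ y → ¬ (x ≡N y)
  ≢N-< x<N y<N x≢y x≡y = x≢y (≡N-<⇒≡ x<N y<N x≡y)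

  n+n≡N0 : n + n ≡N 0
  n+n≡N0 = subst (_≡N 0) N≡n+n (+N 0)

  reflection-reaches-b : ∀ i → Star (NonAdj n) (i , true) b
  reflection-reaches-b i with toℕ i ℕ.≟ 0 | toℕ i ℕ.≟ n
  ... | yes i≡0 | _       = subst (λ j → Star (NonAdj n) (j , true) b) (sym (FinP.toℕ-injective i≡0)) ε
  ... | no _    | yes i≡n = reflections-nonadj i one 1≢i 1≢n+i ◅ reflections-nonadj one Fin.zero (λ ()) 0≢n+1 ◅ ε
    where
    one : Fin N
    one = Fin.suc Fin.zero
    1≢i : 1 ≢ toℕ i
    1≢i 1≡i = case trans 1≡i i≡n of λ ()
    1≢n+i : ¬ (1 ≡N n + toℕ i)
    1≢n+i 1≡n+i = ≢N-< (s≤s (s≤s z≤n)) (s≤s z≤n) (λ ()) (≡N-trans 1≡n+i (subst (λ x → n + x ≡N 0) (sym i≡n) n+n≡N0))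
    0≢n+1 : ¬ (0 ≡N n + 1)
    0≢n+1 = ≢N-< (s≤s z≤n) (subst (n + 1 <_) (sym N≡n+n) (ℕP.+-monoʳ-< n (s≤s (s≤s z≤n)))) (λ ())
  ... | no i≢0  | no i≢n  = reflections-nonadj i Fin.zero (≢-sym i≢0) 0≢n+i ◅ ε
    where
    0≢n+i : ¬ (0 ≡N n + toℕ i)
    0≢n+i 0≡n+i = ≢N-< (FinP.toℕ<n i) n<N i≢n (≡N-trans (+n-involutive 0≡n+i) (mod-≡ (cong (_% N) (ℕP.+-identityʳ n))))

  rotation-reaches-b : ∀ i → toℕ i ≢ 0 → toℕ i ≢ n → Star (NonAdj n) (i , false) b
  rotation-reaches-b i i≢0 i≢n = rotation-b-nonadj i i≢0 i≢n ◅ ε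

  rotation-power-∣ : ∀ x m → x ∣ N → x ∣ toℕ (proj₁ (powQ n ([ x ] , false) m))
  rotation-power-∣ x m x∣N = subst (x ∣_) (sym toℕ-power) (%-presˡ-∣ (∣m⇒∣m*n (suc m) (%-presˡ-∣ ∣-refl x∣N)) x∣N)
    where
    toℕ-power : toℕ (proj₁ (powQ n ([ x ] , false) m)) ≡ (x % N * suc m) % N
    toℕ-power = trans (cong (toℕ ∘ proj₁) (rotation-power [ x ] m))
                      (trans (toℕ-[]≡% (toℕ [ x ] * suc m)) (cong (λ y → (y * suc m) % N) (toℕ-[]≡% x)))

  rotations-nonadj : ∀ {x y} → x < N → y < N → x ∣ N → y ∣ N → ¬ x ∣ y → ¬ y ∣ x →
                     NonAdj n ([ x ] , false) ([ y ] , false)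
  rotations-nonadj {x} {y} x<N y<N x∣N y∣N x∤y y∤x (_ , m , inj₁ aʸ≡aˣᵐ) =
    x∤y (subst (x ∣_) (trans (cong (toℕ ∘ proj₁) (sym aʸ≡aˣᵐ)) (toℕ-[]-< y<N)) (rotation-power-∣ x m x∣N))
  rotations-nonadj {x} {y} x<N y<N x∣N y∣N x∤y y∤x (_ , m , inj₂ aˣ≡aʸᵐ) =
    y∤x (subst (y ∣_) (trans (cong (toℕ ∘ proj₁) (sym aˣ≡aʸᵐ)) (toℕ-[]-< x<N)) (rotation-power-∣ y m y∣N))

  aⁿ·aⁿ≡e : powQ n aⁿ 1 ≡ e
  aⁿ·aⁿ≡e = trans (rotation-power [ n ] 1) (cong (_, false) (toℕ-injective-mod (begin
    toℕ [ toℕ [ n ] * 2 ]  ≈⟨ toℕ-[] (toℕ [ n ] * 2) ⟩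
    toℕ [ n ] * 2          ≡⟨ cong (_* 2) toℕ-[n] ⟩
    n * 2                  ≡⟨ ℕP.*-comm n 2 ⟩
    N                      ≈⟨ +N 0 ⟩
    0                      ∎)))
    where open ≡N-Reasoning

  module PowerOfTwo (t : ℕ) (n≡2ᵗ : n ≡ 2 ^ t) where

    aⁿ-dominating : Dominating n aⁿ
    aⁿ-dominating (i , true)  w≢aⁿ = w≢aⁿ , 1 , inj₁ (sym (reflection² i))
    aⁿ-dominating (i , false) w≢aⁿ with toℕ i ℕ.≟ 0
    ... | yes i≡0 = w≢aⁿ , 1 , inj₂ (trans (cong (_, false) (FinP.toℕ-injective i≡0)) (sym aⁿ·aⁿ≡e))
    ... | no i≢0 with odd-multiple-of-power-of-two t (toℕ i) (ℕP.n≢0⇒n>0 i≢0)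
                        (subst (λ m → toℕ i < 2 * m) n≡2ᵗ (FinP.toℕ<n i))
    ...   | c , q , i[c+1]≡2ᵗ[2q+1] =
      w≢aⁿ , c , inj₁ (sym (trans (rotation-power i c) (cong (_, false) (toℕ-injective-mod (begin
        toℕ [ toℕ i * suc c ]     ≈⟨ toℕ-[] (toℕ i * suc c) ⟩
        toℕ i * suc c             ≡⟨ i[c+1]≡2ᵗ[2q+1] ⟩
        2 ^ t + q * (2 * 2 ^ t)   ≡⟨ cong (λ m → m + q * (2 * m)) n≡2ᵗ ⟨
        n + q * N                 ≈⟨ mod-≡ (DM.[m+kn]%n≡m%n n q N) ⟩
        n                         ≈⟨ toℕ-[] n ⟨
        toℕ [ n ]                 ∎)))))
      where open ≡N-Reasoning

  -- For n = 2ˢ·o with o odd, o ≥ 3: a^(2ˢ⁺¹) and aⁿ generate cyclic subgroups neither containing the other.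
  module NotPowerOfTwo (s q : ℕ) (n≡2ˢo : n ≡ 2 ^ s * suc (suc q + suc q)) where

    private
      o j : ℕ
      o = suc (suc q + suc q)
      j = 2 * 2 ^ s

      instance
        2ˢ≢0 : ℕ.NonZero (2 ^ s)
        2ˢ≢0 = ℕP.m^n≢0 2 s

      0<j : 0 < j
      0<j = ℕP.*-monoʳ-< 2 (ℕP.m^n>0 2 s)

      N≡o*j : N ≡ o * j
      N≡o*j = trans (cong (2 *_) n≡2ˢo) (trans (sym (ℕP.*-assoc 2 (2 ^ s) o)) (ℕP.*-comm j o))

      j<N : j < N
      j<N = subst (j <_) (trans (ℕP.*-comm j o) (sym N≡o*j))
                  (ℕP.m<m*n j o {{ℕ.>-nonZero 0<j}} (s≤s (s≤s z≤n)))

      j∤n : ¬ j ∣ n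
      j∤n j∣n = 2∤odd (suc q) (*-cancelˡ-∣ (2 ^ s) (subst₂ _∣_ (ℕP.*-comm 2 (2 ^ s)) n≡2ˢo j∣n))

      n∤j : ¬ n ∣ j
      n∤j n∣j = case ℕP.≤-trans (ℕP.m≤n+m (suc q) q) (ℕP.≤-pred (ℕP.≤-pred (∣⇒≤ o∣2))) of λ ()
        where
        o∣2 : o ∣ 2
        o∣2 = *-cancelˡ-∣ (2 ^ s) (subst₂ _∣_ n≡2ˢo (ℕP.*-comm 2 (2 ^ s)) n∣j)

    aⁿ-reaches-b : Star (NonAdj n) aⁿ b
    aⁿ-reaches-b = rotations-nonadj n<N j<N (n∣m*n 2) (divides o N≡o*j) n∤j j∤n
                 ◅ rotation-reaches-b [ j ] (λ j≡0 → ℕP.<⇒≢ 0<j (sym (trans (sym (toℕ-[]-< j<N)) j≡0)))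
                                            (λ j≡n → n∤j (subst (n ∣_) (trans (sym j≡n) (toℕ-[]-< j<N)) ∣-refl))

  module Spectrum (adj? : ∀ u v → Dec (PowerAdj n u v)) where
    open LaplacianProperties n adj?

    ν≢0 : ν ≢ 0ℚ
    ν≢0 = fromℕ≢0 (4 * n)

    multiplicity-two : IsPowerOf2 n → EigenMultiplicity n L ν 2
    multiplicity-two (t , n≡2ᵗ) =
      (domVectors , domVectors-eigen , domVectors-independent) ,
      λ w eigen → let (c , nontrivial , c·w[e]≡0 , c·w[b]≡0) = two-equations-three-unknowns (λ i → w i e) (λ i → w i b)
                  in ¬LinIndep-eigenvectors reach w eigen c nontrivial c·w[b]≡0 (Fin.suc Fin.zero)
                       λ { Fin.zero _ → c·w[e]≡0 ; (Fin.suc Fin.zero) 1≢1 → contradiction refl 1≢1 }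
      where
      open PowerOfTwo t n≡2ᵗ
      D : Fin 2 → Q n
      D Fin.zero    = e
      D (Fin.suc _) = aⁿ
      D-injective : ∀ {i j} → D i ≡ D j → i ≡ j
      D-injective {Fin.zero}         {Fin.zero}         _    = refl
      D-injective {Fin.zero}         {Fin.suc Fin.zero} e≡aⁿ = contradiction e≡aⁿ e≢aⁿ
      D-injective {Fin.suc Fin.zero} {Fin.zero}         aⁿ≡e = contradiction (sym aⁿ≡e) e≢aⁿ
      D-injective {Fin.suc Fin.zero} {Fin.suc Fin.zero} _    = refl
      D-dominating : ∀ i → Dominating n (D i)
      D-dominating Fin.zero    = e-dominating
      D-dominating (Fin.suc _) = aⁿ-dominating
      reach : ∀ u → ¬ (∃ λ i → u ≡ D i) → Star (NonAdj n) u b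
      reach (i , true)  _   = reflection-reaches-b i
      reach (i , false) u∉D = rotation-reaches-b i
        (λ i≡0 → u∉D (Fin.zero , cong (_, false) (FinP.toℕ-injective i≡0)))
        (λ i≡n → u∉D (Fin.suc Fin.zero , cong (_, false) (FinP.toℕ-injective (trans i≡n (sym toℕ-[n])))))
      b∉D : ¬ ∃ λ i → b ≡ D i
      b∉D (Fin.zero , ())
      b∉D (Fin.suc Fin.zero , ())
      open DominatingFamily ν≢0 D D-injective D-dominating b b∉D

    multiplicity-one : ¬ IsPowerOf2 n → EigenMultiplicity n L ν 1
    multiplicity-one n≢2ᵗ = from-two-adic (two-adic n (s≤s z≤n))
      where
      from-two-adic : (∃[ s ] ∃[ q ] n ≡ 2 ^ s * suc (q + q)) → EigenMultiplicity n L ν 1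
      from-two-adic (s , zero , n≡2ˢ) = contradiction (s , trans n≡2ˢ (ℕP.*-identityʳ (2 ^ s))) n≢2ᵗ
      from-two-adic (s , suc q , n≡2ˢo) =
        (domVectors , domVectors-eigen , domVectors-independent) ,
        λ w eigen → let (c , nontrivial , c·w[b]≡0) = one-equation-two-unknowns (λ i → w i b)
                    in ¬LinIndep-eigenvectors reach w eigen c nontrivial c·w[b]≡0 Fin.zero
                         λ { Fin.zero 0≢0 → contradiction refl 0≢0 }
        where
        open NotPowerOfTwo s q n≡2ˢo
        D : Fin 1 → Q n
        D _ = e
        D-injective : ∀ {i j} → D i ≡ D j → i ≡ j
        D-injective {Fin.zero} {Fin.zero} _ = refl
        reach : ∀ u → ¬ (∃ λ i → u ≡ D i) → Star (NonAdj n) u b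
        reach (i , true)  _   = reflection-reaches-b i
        reach (i , false) u≢e with toℕ i ℕ.≟ n
        ... | yes i≡n = subst (λ i → Star (NonAdj n) (i , false) b)
                              (FinP.toℕ-injective (trans toℕ-[n] (sym i≡n))) aⁿ-reaches-b
        ... | no i≢n  = rotation-reaches-b i (λ i≡0 → u≢e (Fin.zero , cong (_, false) (FinP.toℕ-injective i≡0))) i≢n
        D-dominating : ∀ i → Dominating n (D i)
        D-dominating _ = e-dominating
        b∉D : ¬ ∃ λ i → b ≡ D i
        b∉D (Fin.zero , ())
        open DominatingFamily ν≢0 D D-injective D-dominating b b∉D

theorem3p9 : (n : ℕ) → 2 ≤ n → (adj? : ∀ u v → Dec (PowerAdj n u v)) →
    (IsPowerOf2 n → EigenMultiplicity n (Laplacian.L n adj?) ((+ (4 * n)) / 1) 2)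
    × (¬ IsPowerOf2 n → EigenMultiplicity n (Laplacian.L n adj?) ((+ (4 * n)) / 1) 1)
theorem3p9 zero          ()           adj?
theorem3p9 (suc zero)    (s≤s ())     adj?
theorem3p9 (suc (suc k)) _            adj? = multiplicity-two , multiplicity-one
  where open Dicyclic.Spectrum k adj?
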